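{- For every integer $n\geq2$, $p_{3,n}(n)-p_{1,n-1}(n)=0$; and for every integer $n\geq1$, $p_{3,n+1}(n)-p_{1,n}(n)=1$.
   Context: A partition of $n$ is a finite multiset of positive integers summing to $n$. For positive integers $A,a$ and a partition $\pi$, $\mathrm{mex}_{A,a}(\pi)$ is the smallest element of $\{a,a+A,a+2A,\dots\}$ that is not a part of $\pi$. $p_{A,a}(n)$ is the number of partitions $\pi$ of $n$ with $\mathrm{mex}_{A,a}(\pi)\equiv a \pmod{2A}$. -}

module Defs where

open import Data.Nat using (ℕ; zero; suc; _+_; _*_; _∸_; _≤?_; _≟_; NonZero)
open import Data.Nat.DivMod using (_%_)
open import Data.List using (List; []; _∷_; _++_; map; concatMap; filter; length; upTo; replicate)
open import Data.List.Membership.DecPropositional _≟_ using (_∈?_)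
open import Relation.Nullary using (does)
open import Relation.Binary.PropositionalEquality using (_≡_)
open import Data.Bool using (Bool; true; false; if_then_else_)

-- Partitions are represented as finite multisets of positive integers,
-- encoded canonically as non-increasing lists.
-- partsUpTo m n : all partitions of n all of whose parts are ≤ m
-- (each exactly once): choose the multiplicity j of the part m, then
-- recurse on parts ≤ m-1.
partsUpTo : ℕ → ℕ → List (List ℕ)
partsUpTo zero zero = [] ∷ []
partsUpTo zero (suc n) = []
partsUpTo (suc m) n =
  concatMap (λ j → map (replicate j (suc m) ++_) (partsUpTo m (n ∸ j * suc m)))
            (filter (λ j → j * suc m ≤? n) (upTo (suc n)))

partitions : ℕ → List (List ℕ)
partitions n = partsUpTo n n

-- smallest element of {x, x+A, x+2A, ...} not in π, searching with fuel;
-- fuel = length π + 1 suffices when A ≥ 1 (the candidates are distinct).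
mexSearch : ℕ → ℕ → ℕ → List ℕ → ℕ
mexSearch zero A x π = x
mexSearch (suc f) A x π = if does (x ∈? π) then mexSearch f A (x + A) π else x

mex : ℕ → ℕ → List ℕ → ℕ
mex A a π = mexSearch (suc (length π)) A a π

p : (A a : ℕ) → .{{NonZero A}} → ℕ → ℕ
p (suc k) a n = length (filter (λ π → mex A a π % (2 * A) ≟ a % (2 * A)) (partitions n))
  where A = suc k

-- Let A ≥ 1 and π be a partition of n < 2a + A. Then π cannot contain both
-- a and a + A, so mex_{A,a}(π) is a if a ∉ π and a + A otherwise; since
-- a + A ≢ a (mod 2A), p_{A,a}(n) is p(n) minus the number of partitions of n
-- containing a. All four pairs (A, a) of the theorem satisfy n < 2a + A, and
-- the partitions of n containing n, n - 1 (for n ≥ 2) or n + 1 are [n],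
-- [n - 1, 1] and none, respectively.
module Submission where

open import Defs
open import Data.Nat using (ℕ; zero; suc; _+_; _*_; _∸_; _≤_; _<_; z≤n; s≤s; _≤?_; _≟_)
open import Data.Nat.Properties
open import Data.Nat.ListAction using (sum)
open import Data.Nat.DivMod using (_%_; m%n<n; m<n⇒m%n≡m; [m+n]%n≡m%n; %-distribˡ-+)
open import Data.Nat.ListAction.Properties using (sum-++)
open import Data.List using (List; []; _∷_; _++_; map; filter; length; upTo; applyUpTo; concatMap; replicate)
open import Data.List.Properties using (filter-accept; filter-reject; filter-none; filter-all; filter-++; map-id; ++-identityʳ; length-map)
open import Data.List.Relation.Unary.All using (All; []; _∷_)
import Data.List.Relation.Unary.All as All
open import Data.List.Relation.Unary.All.Properties using (map⁺; ++⁺; concat⁺; all-filter; applyUpTo⁺₂; replicate⁺)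
open import Data.List.Relation.Unary.Any using (here; there)
open import Data.List.Membership.DecPropositional _≟_ using (_∈?_; _∈_; _∉_)
open import Data.Product using (_×_; _,_)
open import Relation.Nullary using (¬_; yes; no; contradiction)
open import Relation.Unary using (Pred; Decidable)
open import Function.Bundles using (_⇔_; mk⇔; Equivalence)
open import Relation.Nullary.Decidable using (dec-true; dec-false)
open import Function using (id; _∘_)
open import Relation.Binary.PropositionalEquality

withTopCopies : ℕ → ℕ → ℕ → List (List ℕ)
withTopCopies m n j = map (replicate j (suc m) ++_) (partsUpTo m (n ∸ j * suc m))

BoundedPartition : ℕ → ℕ → List ℕ → Set
BoundedPartition m n π = All (_≤ m) π × sum π ≡ n

sum-replicate : ∀ j x → sum (replicate j x) ≡ j * x
sum-replicate zero    x = refl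
sum-replicate (suc j) x = cong (x +_) (sum-replicate j x)

partsUpTo-sound : ∀ m n → All (BoundedPartition m n) (partsUpTo m n)
partsUpTo-sound zero    zero    = ([] , refl) ∷ []
partsUpTo-sound zero    (suc n) = []
partsUpTo-sound (suc m) n =
  concat⁺ (map⁺ (All.map withTopCopies-sound (all-filter (λ j → j * suc m ≤? n) (upTo (suc n)))))
  where
  extend : ∀ {j π} → j * suc m ≤ n → BoundedPartition m (n ∸ j * suc m) π →
           BoundedPartition (suc m) n (replicate j (suc m) ++ π)
  extend {j} {π} jm≤n (parts≤m , sum≡) =
      ++⁺ (replicate⁺ j ≤-refl) (All.map m≤n⇒m≤1+n parts≤m)
    , (begin
      sum (replicate j (suc m) ++ π)    ≡⟨ sum-++ (replicate j (suc m)) π ⟩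
      sum (replicate j (suc m)) + sum π ≡⟨ cong₂ _+_ (sum-replicate j (suc m)) sum≡ ⟩
      j * suc m + (n ∸ j * suc m)       ≡⟨ m+[n∸m]≡n jm≤n ⟩
      n ∎)
    where open ≡-Reasoning
  withTopCopies-sound : ∀ {j} → j * suc m ≤ n → All (BoundedPartition (suc m) n) (withTopCopies m n j)
  withTopCopies-sound {j} jm≤n = map⁺ (All.map (extend jm≤n) (partsUpTo-sound m (n ∸ j * suc m)))

no-multiples≤ : ∀ {d n} f k → (∀ i → n < f i * d) →
                filter (λ j → j * d ≤? n) (applyUpTo f k) ≡ []
no-multiples≤ f k n<fd = filter-none _ (applyUpTo⁺₂ f k (λ i → <⇒≱ (n<fd i)))

multiples≤-below : ∀ d n → n < d → filter (λ j → j * d ≤? n) (upTo (suc n)) ≡ 0 ∷ []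
multiples≤-below d n n<d = trans (filter-accept (λ j → j * d ≤? n) {xs = applyUpTo suc n} z≤n)
  (cong (0 ∷_) (no-multiples≤ suc n (λ i → <-≤-trans n<d (m≤m+n d (i * d)))))

multiples≤-between : ∀ d n → d ≤ n → n < 2 * d →
                     filter (λ j → j * d ≤? n) (upTo (suc n)) ≡ 0 ∷ 1 ∷ []
multiples≤-between zero zero z≤n ()
multiples≤-between d (suc n) d≤n n<2d =
  trans (filter-accept (λ j → j * d ≤? suc n) {xs = 1 ∷ applyUpTo (suc ∘ suc) n} z≤n) (cong (0 ∷_)
  (trans (filter-accept (λ j → j * d ≤? suc n) {xs = applyUpTo (suc ∘ suc) n} 1*d≤n)
  (cong (1 ∷_) (no-multiples≤ (suc ∘ suc) n
    (λ i → <-≤-trans n<2d (*-monoˡ-≤ d {2} {2 + i} (s≤s (s≤s z≤n))))))))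
  where
  1*d≤n : 1 * d ≤ suc n
  1*d≤n = subst (_≤ suc n) (sym (*-identityˡ d)) d≤n

partsUpTo-below : ∀ m n → n ≤ m → partsUpTo (suc m) n ≡ partsUpTo m n
partsUpTo-below m n n≤m = begin
  partsUpTo (suc m) n
    ≡⟨ cong (concatMap (withTopCopies m n)) (multiples≤-below (suc m) n (s≤s n≤m)) ⟩
  map id (partsUpTo m n) ++ []
    ≡⟨ ++-identityʳ _ ⟩
  map id (partsUpTo m n)
    ≡⟨ map-id (partsUpTo m n) ⟩
  partsUpTo m n ∎
  where open ≡-Reasoning

partsUpTo-between : ∀ m n → suc m ≤ n → n < 2 * suc m →
  partsUpTo (suc m) n ≡ partsUpTo m n ++ map (suc m ∷_) (partsUpTo m (n ∸ suc m))
partsUpTo-between m n m<n n<2m = begin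
  partsUpTo (suc m) n
    ≡⟨ cong (concatMap (withTopCopies m n)) (multiples≤-between (suc m) n m<n n<2m) ⟩
  map id (partsUpTo m n) ++ withTopCopies m n 1 ++ []
    ≡⟨ cong₂ _++_ (map-id (partsUpTo m n)) (++-identityʳ _) ⟩
  partsUpTo m n ++ map (suc m ∷_) (partsUpTo m (n ∸ 1 * suc m))
    ≡⟨ cong (λ k → partsUpTo m n ++ map (suc m ∷_) (partsUpTo m (n ∸ k))) (*-identityˡ (suc m)) ⟩
  partsUpTo m n ++ map (suc m ∷_) (partsUpTo m (n ∸ suc m)) ∎
  where open ≡-Reasoning

All≤⇒∉ : ∀ {m x π} → All (_≤ m) π → m < x → x ∉ π
All≤⇒∉ parts≤m m<x x∈π = <⇒≱ m<x (All.lookup parts≤m x∈π)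

∈⇒≤sum : ∀ {x π} → x ∈ π → x ≤ sum π
∈⇒≤sum {π = y ∷ ys} (here refl) = m≤m+n y (sum ys)
∈⇒≤sum {π = y ∷ ys} (there x∈ys) = ≤-trans (∈⇒≤sum x∈ys) (m≤n+m (sum ys) y)

distinct-∈⇒+≤sum : ∀ {x y π} → x ≢ y → x ∈ π → y ∈ π → x + y ≤ sum π
distinct-∈⇒+≤sum x≢y (here refl) (here refl) = contradiction refl x≢y
distinct-∈⇒+≤sum x≢y (here refl) (there y∈π) = +-monoʳ-≤ _ (∈⇒≤sum y∈π)
distinct-∈⇒+≤sum {x} {y} {π = y ∷ ys} x≢y (there x∈π) (here refl) =
  subst (_≤ y + sum ys) (+-comm y x) (+-monoʳ-≤ y (∈⇒≤sum x∈π))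
distinct-∈⇒+≤sum {π = z ∷ zs} x≢y (there x∈π) (there y∈π) =
  ≤-trans (distinct-∈⇒+≤sum x≢y x∈π y∈π) (m≤n+m (sum zs) z)

partsUpTo-zero : ∀ m → partsUpTo m 0 ≡ [] ∷ []
partsUpTo-zero zero    = refl
partsUpTo-zero (suc m) = trans (partsUpTo-below m 0 z≤n) (partsUpTo-zero m)

partsUpTo-one : ∀ m → partsUpTo (suc m) 1 ≡ (1 ∷ []) ∷ []
partsUpTo-one zero    = refl
partsUpTo-one (suc m) = trans (partsUpTo-below (suc m) 1 (s≤s z≤n)) (partsUpTo-one m)

length-filter-∋top : ∀ m n → suc m ≤ n → n < 2 * suc m →
  length (filter (suc m ∈?_) (partsUpTo (suc m) n)) ≡ length (partsUpTo m (n ∸ suc m))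
length-filter-∋top m n m<n n<2m = begin
  length (filter (suc m ∈?_) (partsUpTo (suc m) n))
    ≡⟨ cong (length ∘ filter (suc m ∈?_)) (partsUpTo-between m n m<n n<2m) ⟩
  length (filter (suc m ∈?_) (partsUpTo m n ++ extended))
    ≡⟨ cong length (filter-++ (suc m ∈?_) (partsUpTo m n) extended) ⟩
  length (filter (suc m ∈?_) (partsUpTo m n) ++ filter (suc m ∈?_) extended)
    ≡⟨ cong₂ (λ xs ys → length (xs ++ ys)) none-below all-extended ⟩
  length extended
    ≡⟨ length-map (suc m ∷_) (partsUpTo m (n ∸ suc m)) ⟩
  length (partsUpTo m (n ∸ suc m)) ∎
  where
  open ≡-Reasoning
  extended = map (suc m ∷_) (partsUpTo m (n ∸ suc m))
  none-below : filter (suc m ∈?_) (partsUpTo m n) ≡ []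
  none-below = filter-none (suc m ∈?_)
    (All.map (λ (parts≤m , _) → All≤⇒∉ parts≤m ≤-refl) (partsUpTo-sound m n))
  all-extended : filter (suc m ∈?_) extended ≡ extended
  all-extended = filter-all (suc m ∈?_) (map⁺ (All.universal (λ _ → here refl) _))

partitionsContaining : ℕ → ℕ → List (List ℕ)
partitionsContaining a n = filter (a ∈?_) (partitions n)

partitionsContaining-suc : ∀ n → partitionsContaining (suc n) n ≡ []
partitionsContaining-suc n = filter-none (suc n ∈?_)
  (All.map (λ (parts≤n , _) → All≤⇒∉ parts≤n ≤-refl) (partsUpTo-sound n n))

length-partitionsContaining-self : ∀ m → length (partitionsContaining (suc m) (suc m)) ≡ 1
length-partitionsContaining-self m = begin
  length (partitionsContaining (suc m) (suc m))
    ≡⟨ length-filter-∋top m (suc m) ≤-refl (m<m+n (suc m) (s≤s z≤n)) ⟩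
  length (partsUpTo m (m ∸ m))
    ≡⟨ cong (length ∘ partsUpTo m) (n∸n≡0 m) ⟩
  length (partsUpTo m 0)
    ≡⟨ cong length (partsUpTo-zero m) ⟩
  1 ∎
  where open ≡-Reasoning

partitions-suc : ∀ m → partitions (suc m) ≡ partsUpTo m (suc m) ++ (suc m ∷ []) ∷ []
partitions-suc m = begin
  partsUpTo (suc m) (suc m)
    ≡⟨ partsUpTo-between m (suc m) ≤-refl (m<m+n (suc m) (s≤s z≤n)) ⟩
  partsUpTo m (suc m) ++ map (suc m ∷_) (partsUpTo m (m ∸ m))
    ≡⟨ cong (λ k → partsUpTo m (suc m) ++ map (suc m ∷_) (partsUpTo m k)) (n∸n≡0 m) ⟩
  partsUpTo m (suc m) ++ map (suc m ∷_) (partsUpTo m 0)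
    ≡⟨ cong (λ πs → partsUpTo m (suc m) ++ map (suc m ∷_) πs) (partsUpTo-zero m) ⟩
  partsUpTo m (suc m) ++ (suc m ∷ []) ∷ [] ∎
  where open ≡-Reasoning

length-partitionsContaining-pred : ∀ m → length (partitionsContaining (suc m) (suc (suc m))) ≡ 1
length-partitionsContaining-pred zero    = refl
length-partitionsContaining-pred (suc m) = begin
  length (partitionsContaining (suc a) (suc (suc a)))
    ≡⟨ cong (length ∘ filter (suc a ∈?_)) (partitions-suc (suc a)) ⟩
  length (filter (suc a ∈?_) (partsUpTo (suc a) (suc (suc a)) ++ top))
    ≡⟨ cong length (filter-++ (suc a ∈?_) (partsUpTo (suc a) (suc (suc a))) top) ⟩
  length (filter (suc a ∈?_) (partsUpTo (suc a) (suc (suc a))) ++ filter (suc a ∈?_) top)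
    ≡⟨ cong (λ ys → length (filter (suc a ∈?_) (partsUpTo (suc a) (suc (suc a))) ++ ys)) top-∌ ⟩
  length (filter (suc a ∈?_) (partsUpTo (suc a) (suc (suc a))) ++ [])
    ≡⟨ cong length (++-identityʳ (filter (suc a ∈?_) (partsUpTo (suc a) (suc (suc a))))) ⟩
  length (filter (suc a ∈?_) (partsUpTo (suc a) (suc (suc a))))
    ≡⟨ length-filter-∋top a (suc (suc a)) (n≤1+n _) a+2<2[a+1] ⟩
  length (partsUpTo a (suc a ∸ a))
    ≡⟨ cong (length ∘ partsUpTo a) (m+n∸n≡m 1 a) ⟩
  length (partsUpTo a 1)
    ≡⟨ cong length (partsUpTo-one m) ⟩
  1 ∎
  where
  open ≡-Reasoning
  a = suc m
  top = (suc (suc a) ∷ []) ∷ []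
  a+2<2[a+1] : suc (suc a) < 2 * suc a
  a+2<2[a+1] = subst (_< 2 * suc a) (+-comm (suc a) 1) (+-monoʳ-< (suc a) (s≤s (s≤s z≤n)))
  top-∌ : filter (suc a ∈?_) top ≡ []
  top-∌ = filter-reject (suc a ∈?_) a∉
    where
    a∉ : suc a ∉ suc (suc a) ∷ []
    a∉ (here a≡a+1) = <⇒≢ (n<1+n (suc a)) a≡a+1
    a∉ (there ())

mex-∉ : ∀ A a π → a ∉ π → mex A a π ≡ a
mex-∉ A a π a∉π rewrite dec-false (a ∈? π) a∉π = refl

mex-∈-∉ : ∀ A a π → a ∈ π → a + A ∉ π → mex A a π ≡ a + A
mex-∈-∉ A a π@(_ ∷ _) a∈π a+A∉π
  rewrite dec-true (a ∈? π) a∈π | dec-false (a + A ∈? π) a+A∉π = refl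

2*A≡A+A : ∀ k → 2 * suc k ≡ suc k + suc k
2*A≡A+A k = cong (suc k +_) (+-identityʳ (suc k))

[r+A]%2A≢r : ∀ k {r} → r < 2 * suc k → (r + suc k) % (2 * suc k) ≢ r
[r+A]%2A≢r k {r} r<2A with suc k ≤? r
... | no r≱A = <⇒≢ (m<m+n r (s≤s z≤n)) ∘ sym ∘ trans (sym (m<n⇒m%n≡m r+A<2A))
  where
  r+A<2A : r + suc k < 2 * suc k
  r+A<2A = subst (r + suc k <_) (sym (2*A≡A+A k))
                 (+-monoˡ-< (suc k) (≰⇒> r≱A))
... | yes A≤r = <⇒≢ (∸-monoʳ-< (s≤s z≤n) A≤r) ∘ trans (sym (m<n⇒m%n≡m r∸A<2A)) ∘ trans (sym shift)
  where
  r∸A<2A : r ∸ suc k < 2 * suc k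
  r∸A<2A = ≤-<-trans (m∸n≤m r (suc k)) r<2A
  shift : (r + suc k) % (2 * suc k) ≡ (r ∸ suc k) % (2 * suc k)
  shift = begin
    (r + suc k) % (2 * suc k)               ≡⟨ cong (λ x → (x + suc k) % (2 * suc k)) (sym (m∸n+n≡m A≤r)) ⟩
    (r ∸ suc k + suc k + suc k) % (2 * suc k) ≡⟨ cong (_% (2 * suc k)) (+-assoc (r ∸ suc k) (suc k) (suc k)) ⟩
    (r ∸ suc k + (suc k + suc k)) % (2 * suc k) ≡⟨ cong (λ x → (r ∸ suc k + x) % (2 * suc k)) (sym (2*A≡A+A k)) ⟩
    (r ∸ suc k + 2 * suc k) % (2 * suc k)   ≡⟨ [m+n]%n≡m%n (r ∸ suc k) (2 * suc k) ⟩
    (r ∸ suc k) % (2 * suc k) ∎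
    where open ≡-Reasoning

[a+A]%2A≢a%2A : ∀ k a → (a + suc k) % (2 * suc k) ≢ a % (2 * suc k)
[a+A]%2A≢a%2A k a = [r+A]%2A≢r k (m%n<n a (2 * suc k)) ∘ trans (sym reduce)
  where
  reduce : (a + suc k) % (2 * suc k) ≡ (a % (2 * suc k) + suc k) % (2 * suc k)
  reduce = trans (%-distribˡ-+ a (suc k) (2 * suc k))
    (cong (λ x → (a % (2 * suc k) + x) % (2 * suc k)) (m<n⇒m%n≡m (m<m+n (suc k) (s≤s z≤n))))

length-filter-⇔¬ : ∀ {a p q} {A : Set a} {P : Pred A p} {Q : Pred A q}
  (P? : Decidable P) (Q? : Decidable Q) (xs : List A) → All (λ x → P x ⇔ (¬ Q x)) xs →
  length (filter P? xs) + length (filter Q? xs) ≡ length xs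
length-filter-⇔¬ P? Q? [] [] = refl
length-filter-⇔¬ P? Q? (x ∷ xs) (P⇔¬Q ∷ rest) with P? x | Q? x
... | yes px | yes qx = contradiction qx (Equivalence.to P⇔¬Q px)
... | no ¬px | no ¬qx = contradiction (Equivalence.from P⇔¬Q ¬qx) ¬px
... | yes _  | no _   = cong suc (length-filter-⇔¬ P? Q? xs rest)
... | no _   | yes _  = trans (+-suc _ _) (cong suc (length-filter-⇔¬ P? Q? xs rest))

p+length-partitionsContaining : ∀ k a n → n < a + (a + suc k) →
  p (suc k) a n + length (partitionsContaining a n) ≡ length (partitions n)
p+length-partitionsContaining k a n n<2a+A =
  length-filter-⇔¬ (λ π → mex A a π % (2 * A) ≟ a % (2 * A)) (a ∈?_) (partitions n)
    (All.map (λ (_ , sum≡n) → mk⇔ (counted⇒∉ sum≡n) ∉⇒counted) (partsUpTo-sound n n))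
  where
  A = suc k
  ∉⇒counted : ∀ {π} → a ∉ π → mex A a π % (2 * A) ≡ a % (2 * A)
  ∉⇒counted {π} a∉π = cong (_% (2 * A)) (mex-∉ A a π a∉π)
  counted⇒∉ : ∀ {π} → sum π ≡ n → mex A a π % (2 * A) ≡ a % (2 * A) → a ∉ π
  counted⇒∉ {π} sum≡n counted a∈π =
    [a+A]%2A≢a%2A k a (trans (cong (_% (2 * A)) (sym (mex-∈-∉ A a π a∈π a+A∉π))) counted)
    where
    a+A∉π : a + A ∉ π
    a+A∉π a+A∈π = <⇒≱ n<2a+A (subst (a + (a + A) ≤_) sum≡n
      (distinct-∈⇒+≤sum (<⇒≢ (m<m+n a (s≤s z≤n))) a∈π a+A∈π))

theorem5p4 : ((n : ℕ) → 2 ≤ n → p 3 n n ≡ p 1 (n ∸ 1) n)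
    × ((n : ℕ) → 1 ≤ n → p 3 (suc n) n ≡ p 1 n n + 1)
theorem5p4 = first , second
  where
  first : (n : ℕ) → 2 ≤ n → p 3 n n ≡ p 1 (n ∸ 1) n
  first (suc zero) (s≤s ())
  first (suc (suc m)) _ = +-cancelʳ-≡ 1 (p 3 n n) (p 1 (suc m) n) (begin
    p 3 n n + 1
      ≡⟨ cong (p 3 n n +_) (sym (length-partitionsContaining-self (suc m))) ⟩
    p 3 n n + length (partitionsContaining n n)
      ≡⟨ p+length-partitionsContaining 2 n n (m<m+n n (s≤s z≤n)) ⟩
    length (partitions n)
      ≡⟨ p+length-partitionsContaining 0 (suc m) n n<2[n-1]+1 ⟨
    p 1 (suc m) n + length (partitionsContaining (suc m) n)
      ≡⟨ cong (p 1 (suc m) n +_) (length-partitionsContaining-pred m) ⟩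
    p 1 (suc m) n + 1 ∎)
    where
    open ≡-Reasoning
    n = suc (suc m)
    n<2[n-1]+1 : n < suc m + (suc m + 1)
    n<2[n-1]+1 = s≤s (subst (_≤ m + (suc m + 1)) (+-comm (suc m) 1) (m≤n+m (suc m + 1) m))
  second : (n : ℕ) → 1 ≤ n → p 3 (suc n) n ≡ p 1 n n + 1
  second (suc m) _ = begin
    p 3 (suc n) n
      ≡⟨ +-identityʳ (p 3 (suc n) n) ⟨
    p 3 (suc n) n + 0
      ≡⟨ cong (λ πs → p 3 (suc n) n + length πs) (partitionsContaining-suc n) ⟨
    p 3 (suc n) n + length (partitionsContaining (suc n) n)
      ≡⟨ p+length-partitionsContaining 2 (suc n) n (m≤m+n (suc n) (suc n + 3)) ⟩
    length (partitions n)
      ≡⟨ p+length-partitionsContaining 0 n n (m<m+n n (s≤s z≤n)) ⟨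
    p 1 n n + length (partitionsContaining n n)
      ≡⟨ cong (p 1 n n +_) (length-partitionsContaining-self m) ⟩
    p 1 n n + 1 ∎
    where
    open ≡-Reasoning
    n = suc m
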